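{- If $K$ and $J$ are uniformly continuously searchable closeness spaces, then the binary product closeness space $K\times J$ is uniformly continuously searchable.
   Context: Constructive type theory with function extensionality and propositional extensionality. $\mathbb{N}_\infty$: decreasing binary sequences; $\underline{n}$: $n$ ones then zeros; $\infty$: all ones; $u\preceq v$ iff $\forall n\,(u_n=1\Rightarrow v_n=1)$; $\min$ pointwise. A closeness space is a type $X$ with $c:X\to X\to\mathbb{N}_\infty$ such that $c(x,y)=\infty\iff x=y$, symmetry, and $\min(c(x,y),c(y,z))\preceq c(x,z)$; $C_\varepsilon(x,y)$ means $\underline{\varepsilon}\preceq c(x,y)$. The binary product closeness function on $K\times J$ is $c((k_1,j_1),(k_2,j_2)):=\min(c_K(k_1,k_2),c_J(j_1,j_2))$. A predicate $p$ on a closeness space is decidable if each $p(x)$ is decided, and uniformly continuous if there is $\delta\in\mathbb{N}$ with $C_\delta(x_1,x_2)\Rightarrow(p(x_1)\Leftrightarrow p(x_2))$. A closeness space $X$ is uniformly continuously searchable if for every decidable predicate $p$ given with a modulus of uniform continuity there is $x_0\in X$ such that if some $x\in X$ satisfies $p$ then $p(x_0)$. -}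

module Defs where

open import Data.Bool using (Bool; true; false; _∧_)
open import Data.Nat using (ℕ; zero; suc; _<ᵇ_)
open import Data.Product using (Σ; _×_; _,_; ∃)
open import Relation.Nullary using (Dec)
open import Relation.Binary.PropositionalEquality using (_≡_)
open import Function.Bundles using (_⇔_)

Decreasing : (ℕ → Bool) → Set
Decreasing α = ∀ n → α (suc n) ≡ true → α n ≡ true

record ℕ∞ : Set where
  constructor mkℕ∞
  field
    seq  : ℕ → Bool
    decr : Decreasing seq
open ℕ∞ public

_≼_ : ℕ∞ → ℕ∞ → Set
u ≼ v = ∀ n → seq u n ≡ true → seq v n ≡ true

fromℕ : ℕ → ℕ∞
fromℕ n = mkℕ∞ (λ i → i <ᵇ n) (dec n)
  where
  dec : ∀ n i → (suc i <ᵇ n) ≡ true → (i <ᵇ n) ≡ true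
  dec zero i ()
  dec (suc n) zero _ = Relation.Binary.PropositionalEquality.refl
  dec (suc n) (suc i) p = dec n i p

∞ : ℕ∞
∞ = mkℕ∞ (λ _ → true) (λ _ _ → Relation.Binary.PropositionalEquality.refl)

min : ℕ∞ → ℕ∞ → ℕ∞
min u v = mkℕ∞ (λ n → seq u n ∧ seq v n) (dec (seq u) (seq v) (decr u) (decr v))
  where
  dec : ∀ (a b : ℕ → Bool) → Decreasing a → Decreasing b →
        Decreasing (λ n → a n ∧ b n)
  dec a b da db n p with a (suc n) | b (suc n) | da n | db n
  ... | true | true | f | g with f Relation.Binary.PropositionalEquality.refl
                              | g Relation.Binary.PropositionalEquality.refl
  ...   | x | y rewrite x | y = Relation.Binary.PropositionalEquality.refl
  dec a b da db n () | false | _ | _ | _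
  dec a b da db n () | true | false | _ | _

record ClosenessSpace : Set₁ where
  field
    X   : Set
    c   : X → X → ℕ∞
    -- c(x,y) = ∞ ⇔ x = y  (equality in ℕ∞ read pointwise, justified by funext)
    c-∞   : ∀ x y → (∞ ≼ c x y) ⇔ (x ≡ y)
    c-sym : ∀ x y → c x y ≼ c y x × c y x ≼ c x y
    c-ult : ∀ x y z → min (c x y) (c y z) ≼ c x z

C⟨_⟩ : {X : Set} → (X → X → ℕ∞) → ℕ → X → X → Set
C⟨ c ⟩ ε x y = fromℕ ε ≼ c x y

DecidablePred : {X : Set} → (X → Set) → Set
DecidablePred {X} p = ∀ x → Dec (p x)

UCModulus : {X : Set} → (X → X → ℕ∞) → (X → Set) → ℕ → Set
UCModulus {X} c p δ = ∀ x₁ x₂ → C⟨ c ⟩ δ x₁ x₂ → (p x₁ ⇔ p x₂)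

UCSearchable' : (X : Set) → (X → X → ℕ∞) → Set₁
UCSearchable' X c =
  (p : X → Set) → DecidablePred p → (δ : ℕ) → UCModulus c p δ →
  Σ X λ x₀ → (Σ X p → p x₀)

UCSearchable : ClosenessSpace → Set₁
UCSearchable S = UCSearchable' X c where open ClosenessSpace S

×-c : (K J : ClosenessSpace) →
      (ClosenessSpace.X K × ClosenessSpace.X J) →
      (ClosenessSpace.X K × ClosenessSpace.X J) → ℕ∞
×-c K J (k₁ , j₁) (k₂ , j₂) = min (ClosenessSpace.c K k₁ k₂) (ClosenessSpace.c J j₁ j₂)

-- For each k, searching the fibre {k} × J gives a best j = f k. The predicate
-- k ↦ p (k , f k) inherits the modulus δ of p, because a δ-close k₂ turns the
-- witness (k₁ , f k₁) into a witness (k₂ , f k₁) in the fibre of k₂, which f k₂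
-- then also satisfies. Searching K for this predicate yields (k₀ , f k₀).
module Submission where

open import Defs
open import Data.Product using (_×_; Σ; _,_; proj₁; proj₂)
open import Relation.Binary.PropositionalEquality using (refl)
open import Function.Bundles using (mk⇔; Equivalence)

≼-min : ∀ {w u v} → w ≼ u → w ≼ v → w ≼ min u v
≼-min w≼u w≼v n wₙ rewrite w≼u n wₙ | w≼v n wₙ = refl

module _ (S : ClosenessSpace) where
  open ClosenessSpace S

  c-refl : ∀ x → ∞ ≼ c x x
  c-refl x = Equivalence.from (c-∞ x x) refl

  C-refl : ∀ ε x → C⟨ c ⟩ ε x x
  C-refl ε x n _ = c-refl x n refl

  C-sym : ∀ ε {x y} → C⟨ c ⟩ ε x y → C⟨ c ⟩ ε y x
  C-sym ε {x} {y} Cxy n εₙ = proj₁ (c-sym x y) n (Cxy n εₙ)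

  ucModulus-intro : ∀ {p : X → Set} δ →
    (∀ x y → C⟨ c ⟩ δ x y → p x → p y) → UCModulus c p δ
  ucModulus-intro δ transport x y Cxy =
    mk⇔ (transport x y Cxy) (transport y x (C-sym δ Cxy))

module _ (K J : ClosenessSpace) where
  private
    module K = ClosenessSpace K
    module J = ClosenessSpace J

  ×-C : ∀ ε {k₁ k₂ j₁ j₂} → C⟨ K.c ⟩ ε k₁ k₂ → C⟨ J.c ⟩ ε j₁ j₂ →
        C⟨ ×-c K J ⟩ ε (k₁ , j₁) (k₂ , j₂)
  ×-C ε {k₁} {k₂} {j₁} {j₂} = ≼-min {fromℕ ε} {K.c k₁ k₂} {J.c j₁ j₂}

  fibre-ucModulus : ∀ {p : K.X × J.X → Set} δ → UCModulus (×-c K J) p δ →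
    ∀ k → UCModulus J.c (λ j → p (k , j)) δ
  fibre-ucModulus δ p-uc k j₁ j₂ Cj = p-uc (k , j₁) (k , j₂) (×-C δ (C-refl K δ k) Cj)

  fibre-selector : ∀ {p : K.X × J.X → Set} δ → UCSearchable J →
    DecidablePred p → UCModulus (×-c K J) p δ →
    Σ (K.X → J.X) λ f → ∀ k j → p (k , j) → p (k , f k)
  fibre-selector {p} δ searchJ p? p-uc =
    (λ k → proj₁ (search k)) ,
    (λ k j pkj → proj₂ (search k) (j , pkj))
    where
    search : ∀ k → Σ J.X λ j₀ → Σ J.X (λ j → p (k , j)) → p (k , j₀)
    search k = searchJ (λ j → p (k , j)) (λ j → p? (k , j)) δ (fibre-ucModulus δ p-uc k)

  selected-ucModulus : ∀ {p : K.X × J.X → Set} δ (f : K.X → J.X) →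
    (∀ k j → p (k , j) → p (k , f k)) → UCModulus (×-c K J) p δ →
    UCModulus K.c (λ k → p (k , f k)) δ
  selected-ucModulus δ f f-best p-uc = ucModulus-intro K δ λ k₁ k₂ Ck pk₁ →
    f-best k₂ (f k₁)
      (Equivalence.to (p-uc (k₁ , f k₁) (k₂ , f k₁) (×-C δ Ck (C-refl J δ (f k₁)))) pk₁)

lemma3p91 : (K J : ClosenessSpace) → UCSearchable K → UCSearchable J →
    UCSearchable' (ClosenessSpace.X K × ClosenessSpace.X J) (×-c K J)
lemma3p91 K J searchK searchJ p p? δ p-uc with fibre-selector K J δ searchJ p? p-uc
... | f , f-best with searchK (λ k → p (k , f k)) (λ k → p? (k , f k)) δ
                              (selected-ucModulus K J δ f f-best p-uc)
... | k₀ , k₀-best = (k₀ , f k₀) , λ ((k , j) , pkj) → k₀-best (k , f-best k j pkj)
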